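{- Let $G$ be a graph of order $n$ with diameter $D(G)=2$ such that its complement $G^c$ is connected. Then $\operatorname{Sd}_s(G,G^c)\ge n-\varpi(G)$. Moreover, if $D(G^c)\ge 3$ and $\varpi(G)=2$, then $\operatorname{Sd}_s(G,G^c)=n-2$.
   Context: All graphs are finite, simple and undirected; $G^c$ denotes the complement of $G$ on the same vertex set and $D(H)$ the diameter of a connected graph $H$. For a connected graph $H$, $d_H(x,y)$ is the length of a shortest $x$–$y$ path. A vertex $w$ strongly resolves two vertices $u,v$ of $H$ if $d_H(u,w)=d_H(u,v)+d_H(v,w)$ or $d_H(v,w)=d_H(v,u)+d_H(u,w)$. A set $S\subseteq V(H)$ is a strong metric generator for $H$ if every two distinct vertices of $H$ are strongly resolved by some vertex of $S$. For connected graphs $G_1,\dots,G_k$ on a common vertex set $V$, $\operatorname{Sd}_s(G_1,\dots,G_k)$ denotes the minimum cardinality of a set $S\subseteq V$ that is a strong metric generator for every $G_i$. Two vertices $x,y$ are true twins in $G$ if $N_G[x]=N_G[y]$ (closed neighbourhoods). A twin-free clique of $G$ is a clique containing no two distinct true twins of $G$, and $\varpi(G)$ is the maximum cardinality of a twin-free clique of $G$. -}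

module Defs where

open import Data.Nat using (ℕ; zero; suc; _+_; _≤_)
open import Data.Fin using (Fin; _≟_)
open import Data.Fin.Subset using (Subset; _∈_)
open import Data.Bool using (Bool; true; false; not; _∧_; _∨_)
open import Data.Product using (Σ; ∃; _×_; _,_)
open import Data.Sum using (_⊎_)
open import Relation.Nullary using (¬_; yes; no)
open import Relation.Nullary.Decidable using (⌊_⌋)
open import Data.Empty using (⊥-elim)
open import Data.Bool.Properties using (∧-zeroʳ)
import Data.Fin.Subset as FS
open import Relation.Binary.PropositionalEquality using (_≡_; _≢_; refl; sym)

record Graph (n : ℕ) : Set where
  field
    adj    : Fin n → Fin n → Bool
    adj-sym    : ∀ u v → adj u v ≡ adj v u
    adj-irrefl : ∀ u → adj u u ≡ false
open Graph public

eqb : ∀ {n} → Fin n → Fin n → Bool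
eqb u v = ⌊ u ≟ v ⌋

eqb-sym : ∀ {n} (u v : Fin n) → eqb u v ≡ eqb v u
eqb-sym u v with u ≟ v | v ≟ u
... | yes _ | yes _ = refl
... | no _  | no _  = refl
... | yes p | no q  = ⊥-elim (q (sym p))
... | no p  | yes q = ⊥-elim (p (sym q))

eqb-refl : ∀ {n} (u : Fin n) → eqb u u ≡ true
eqb-refl u with u ≟ u
... | yes _ = refl
... | no p  = ⊥-elim (p refl)

complement : ∀ {n} → Graph n → Graph n
complement G = record
  { adj = λ u v → not (adj G u v) ∧ not (eqb u v)
  ; adj-sym = λ u v → lemma u v
  ; adj-irrefl = λ u → lemma2 u
  }
  where
  lemma : ∀ u v → (not (adj G u v) ∧ not (eqb u v)) ≡ (not (adj G v u) ∧ not (eqb v u))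
  lemma u v rewrite adj-sym G u v | eqb-sym u v = refl
  lemma2 : ∀ u → (not (adj G u u) ∧ not (eqb u u)) ≡ false
  lemma2 u rewrite eqb-refl u | ∧-zeroʳ (not (adj G u u)) = refl

data Walk {n : ℕ} (G : Graph n) : Fin n → Fin n → ℕ → Set where
  nil  : ∀ {u} → Walk G u u zero
  cons : ∀ {u w v k} → adj G u w ≡ true → Walk G w v k → Walk G u v (suc k)

Dist : ∀ {n} → Graph n → Fin n → Fin n → ℕ → Set
Dist G u v d = Walk G u v d × (∀ k → Walk G u v k → d ≤ k)

Connected : ∀ {n} → Graph n → Set
Connected G = ∀ u v → ∃ λ k → Walk G u v k

HasDiameter : ∀ {n} → Graph n → ℕ → Set
HasDiameter G D =
  Connected G × (∀ u v d → Dist G u v d → d ≤ D)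
  × Σ _ λ u → Σ _ λ v → Dist G u v D

StronglyResolves : ∀ {n} → Graph n → Fin n → Fin n → Fin n → Set
StronglyResolves G w u v =
  (Σ ℕ λ a → Σ ℕ λ b → Σ ℕ λ c →
     Dist G u w a × Dist G u v b × Dist G v w c × a ≡ b + c)
  ⊎
  (Σ ℕ λ a → Σ ℕ λ b → Σ ℕ λ c →
     Dist G v w a × Dist G v u b × Dist G u w c × a ≡ b + c)

StrongMetricGenerator : ∀ {n} → Graph n → Subset n → Set
StrongMetricGenerator G S =
  ∀ u v → u ≢ v → Σ _ λ w → w ∈ S × StronglyResolves G w u v

closedAdj : ∀ {n} → Graph n → Fin n → Fin n → Bool
closedAdj G x z = eqb x z ∨ adj G x z

TrueTwins : ∀ {n} → Graph n → Fin n → Fin n → Set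
TrueTwins G x y = ∀ z → closedAdj G x z ≡ closedAdj G y z

IsClique : ∀ {n} → Graph n → Subset n → Set
IsClique G K = ∀ x y → x ∈ K → y ∈ K → x ≢ y → adj G x y ≡ true

IsTwinFreeClique : ∀ {n} → Graph n → Subset n → Set
IsTwinFreeClique G K =
  IsClique G K × (∀ x y → x ∈ K → y ∈ K → x ≢ y → ¬ TrueTwins G x y)

IsVarpi : ∀ {n} → Graph n → ℕ → Set
IsVarpi G k =
  (Σ _ λ K → IsTwinFreeClique G K × FS.∣ K ∣ ≡ k)
  × (∀ K → IsTwinFreeClique G K → FS.∣ K ∣ ≤ k)

IsSds : ∀ {n} → Graph n → Graph n → ℕ → Set
IsSds G₁ G₂ m =
  (Σ _ λ S → StrongMetricGenerator G₁ S × StrongMetricGenerator G₂ S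
              × FS.∣ S ∣ ≡ m)
  × (∀ S → StrongMetricGenerator G₁ S → StrongMetricGenerator G₂ S
          → m ≤ FS.∣ S ∣)

-- If S is a strong metric generator of a graph of diameter two and x, y ∉ S,
-- some w ∈ S strongly resolves them, putting (say) y on a shortest x–w path.
-- That is impossible if x, y are non-adjacent (the path would have length at
-- least 3) or true twins (y is then no closer to w than x). Hence V ∖ S is a
-- twin-free clique and |S| ≥ n − ϖ(G).
-- For the equality, let u, v be at distance d ≥ 3 in Gᶜ and p the vertex before
-- v on a shortest Gᶜ-path. Then u ~ p, u ~ v and p ≁ v in G, so v strongly
-- resolves u and p in both G and Gᶜ, and V ∖ {u, p} is a simultaneous strong
-- metric generator of size n − 2.
module Submission where

open import Defs
open import Data.Nat using (ℕ; zero; suc; _+_; _∸_; _≤_; _<_; z≤n; s≤s; s≤s⁻¹)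
open import Data.Nat.Properties
  using (≤-refl; ≤-trans; ≤-<-trans; ≤-antisym; n≤1+n; <-irrefl; ≮⇒≥; m<m+n; m<n+m;
         +-comm; +-identityʳ; +-monoʳ-≤; m≤n+m∸n; m≤n+o⇒m∸n≤o; ∸-monoʳ-≤; anyUpTo?)
open import Data.Nat.Induction using (<-rec)
open import Data.Fin using (Fin; _≟_)
open import Data.Fin.Subset using (Subset; ∣_∣; ∁; ⁅_⁆; _∪_; _∈_; _∉_; _⊂_)
open import Data.Fin.Subset.Properties
  using (_∈?_; x∉p⇒x∈∁p; x∈∁p⇒x∉p; x∉∁p⇒x∈p; x∈p∪q⁻; x∈⁅y⁆⇒x≡y; x∈⁅x⁆; ∣⁅x⁆∣≡1;
         ∣∁p∣≡n∸∣p∣; p⊂q⇒∣p∣<∣q∣; p⊆p∪q; q⊆p∪q)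
import Data.Fin.Properties as Fin
open import Data.Bool using (true; false)
import Data.Bool.Properties as Bool
open import Data.Product using (Σ; ∃; _×_; _,_; proj₂)
open import Data.Sum using (_⊎_; inj₁; inj₂; [_,_]; swap)
open import Relation.Nullary using (¬_; Dec; yes; no; contradiction)
open import Relation.Nullary.Decidable using (_×-dec_)
open import Function using (_∘_)
open import Relation.Binary.PropositionalEquality using (_≡_; _≢_; refl; sym; trans; subst)

private variable n : ℕ

-- y lies on a shortest x–w path; StronglyResolves G w u v unfolds to
-- Between G u v w ⊎ Between G v u w.
Between : Graph n → Fin n → Fin n → Fin n → Set
Between G x y w = Σ ℕ λ a → Σ ℕ λ b → Σ ℕ λ c →
  Dist G x w a × Dist G x y b × Dist G y w c × a ≡ b + c

DiameterAtMost : Graph n → ℕ → Set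
DiameterAtMost G D = ∀ u v d → Dist G u v d → d ≤ D

pair : Fin n → Fin n → Subset n
pair a b = ⁅ a ⁆ ∪ ⁅ b ⁆

∈∁pair : ∀ {a b x : Fin n} → x ≢ a → x ≢ b → x ∈ ∁ (pair a b)
∈∁pair {a = a} {b} x≢a x≢b = x∉p⇒x∈∁p λ x∈ab →
  [ x≢a ∘ x∈⁅y⁆⇒x≡y a , x≢b ∘ x∈⁅y⁆⇒x≡y b ] (x∈p∪q⁻ ⁅ a ⁆ ⁅ b ⁆ x∈ab)

∉∁pair : ∀ {a b x : Fin n} → x ∉ ∁ (pair a b) → x ≡ a ⊎ x ≡ b
∉∁pair {a = a} {b} x∉ with x∈p∪q⁻ ⁅ a ⁆ ⁅ b ⁆ (x∉∁p⇒x∈p x∉)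
... | inj₁ x∈a = inj₁ (x∈⁅y⁆⇒x≡y a x∈a)
... | inj₂ x∈b = inj₂ (x∈⁅y⁆⇒x≡y b x∈b)

∣∁pair∣≤n∸2 : ∀ {a b : Fin n} → a ≢ b → ∣ ∁ (pair a b) ∣ ≤ n ∸ 2
∣∁pair∣≤n∸2 {n} {a} {b} a≢b =
  subst (_≤ n ∸ 2) (sym (∣∁p∣≡n∸∣p∣ (pair a b))) (∸-monoʳ-≤ n 2≤∣pair∣)
  where
  ⁅a⁆⊂pair : ⁅ a ⁆ ⊂ pair a b
  ⁅a⁆⊂pair = p⊆p∪q ⁅ b ⁆ , b , q⊆p∪q ⁅ a ⁆ ⁅ b ⁆ (x∈⁅x⁆ b) ,
             λ b∈a → a≢b (sym (x∈⁅y⁆⇒x≡y a b∈a))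
  2≤∣pair∣ : 2 ≤ ∣ pair a b ∣
  2≤∣pair∣ = subst (λ k → suc k ≤ ∣ pair a b ∣) (∣⁅x⁆∣≡1 a) (p⊂q⇒∣p∣<∣q∣ ⁅a⁆⊂pair)

m∸n≤o⇒m∸o≤n : ∀ m n o → m ∸ n ≤ o → m ∸ o ≤ n
m∸n≤o⇒m∸o≤n m n o m∸n≤o = m≤n+o⇒m∸n≤o m o
  (subst (m ≤_) (+-comm n o) (≤-trans (m≤n+m∸n m n) (+-monoʳ-≤ n m∸n≤o)))

module _ (G : Graph n) where

  walk₀⇒≡ : ∀ {u v} → Walk G u v 0 → u ≡ v
  walk₀⇒≡ nil = refl

  walk₁⇒adj : ∀ {u v} → Walk G u v 1 → adj G u v ≡ true
  walk₁⇒adj (cons e nil) = e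

  adj⇒≢ : ∀ {u v} → adj G u v ≡ true → u ≢ v
  adj⇒≢ {u} e refl = contradiction (trans (sym e) (adj-irrefl G u)) λ ()

  walk-snoc : ∀ {u p v k} → Walk G u p k → adj G p v ≡ true → Walk G u v (suc k)
  walk-snoc nil         e = cons e nil
  walk-snoc (cons e′ w) e = cons e′ (walk-snoc w e)

  walk-unsnoc : ∀ {u v k} → Walk G u v (suc k) → ∃ λ p → Walk G u p k × adj G p v ≡ true
  walk-unsnoc (cons e nil)          = _ , nil , e
  walk-unsnoc (cons e (cons e′ w)) with walk-unsnoc (cons e′ w)
  ... | p , w′ , e″ = p , cons e w′ , e″

  walk? : ∀ k u v → Dec (Walk G u v k)
  walk? zero    u v with u ≟ v
  ... | yes refl = yes nil
  ... | no  u≢v  = no λ w → u≢v (walk₀⇒≡ w)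
  walk? (suc k) u v with Fin.any? (λ z → Bool._≟_ (adj G u z) true ×-dec walk? k z v)
  ... | yes (_ , e , w) = yes (cons e w)
  ... | no  ∄z          = no λ { (cons e w) → ∄z (_ , e , w) }

  ≢⇒1≤walk : ∀ {u v k} → u ≢ v → Walk G u v k → 1 ≤ k
  ≢⇒1≤walk u≢v nil        = contradiction refl u≢v
  ≢⇒1≤walk u≢v (cons _ _) = s≤s z≤n

  nonadjacent⇒2≤walk : ∀ {u v k} → u ≢ v → adj G u v ≡ false → Walk G u v k → 2 ≤ k
  nonadjacent⇒2≤walk u≢v _  nil                 = contradiction refl u≢v
  nonadjacent⇒2≤walk _   ¬e w@(cons _ nil)      = contradiction (trans (sym ¬e) (walk₁⇒adj w)) λ ()
  nonadjacent⇒2≤walk _   _  (cons _ (cons _ _)) = s≤s (s≤s z≤n)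

  walk⇒Dist : ∀ {u v} k → Walk G u v k → ∃ (Dist G u v)
  walk⇒Dist {u} {v} = <-rec (λ k → Walk G u v k → ∃ (Dist G u v)) shorten
    where
    shorten : ∀ k → (∀ {j} → j < k → Walk G u v j → ∃ (Dist G u v)) →
              Walk G u v k → ∃ (Dist G u v)
    shorten k rec w with anyUpTo? (λ j → walk? j u v) k
    ... | yes (j , j<k , w′) = rec j<k w′
    ... | no  ∄shorter       = k , w , λ j wj → ≮⇒≥ λ j<k → ∄shorter (j , j<k , wj)

  Connected⇒Dist : Connected G → ∀ u v → ∃ (Dist G u v)
  Connected⇒Dist conn u v = walk⇒Dist _ (proj₂ (conn u v))

  Dist-refl : ∀ {u} → Dist G u u 0
  Dist-refl = nil , λ _ _ → z≤n

  adj⇒Dist₁ : ∀ {u v} → adj G u v ≡ true → Dist G u v 1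
  adj⇒Dist₁ e = cons e nil , λ _ → ≢⇒1≤walk (adj⇒≢ e)

  Dist₂ : ∀ {u z v} → adj G u z ≡ true → adj G z v ≡ true → adj G u v ≡ false → u ≢ v →
          Dist G u v 2
  Dist₂ e e′ ¬e u≢v = cons e (cons e′ nil) , λ _ → nonadjacent⇒2≤walk u≢v ¬e

  Dist-pos⇒≢ : ∀ {u v k} → Dist G u v k → 1 ≤ k → u ≢ v
  Dist-pos⇒≢ (_ , minimal) 1≤k refl with ≤-trans 1≤k (minimal 0 nil)
  ... | ()

  Dist≥2⇒nonadjacent : ∀ {u v k} → Dist G u v k → 2 ≤ k → adj G u v ≡ false
  Dist≥2⇒nonadjacent {u} {v} (_ , minimal) 2≤k with adj G u v in e
  ... | false = refl
  ... | true  with ≤-trans 2≤k (minimal 1 (cons e nil))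
  ...   | s≤s ()

  Dist-unsnoc : ∀ {u v k} → Dist G u v (suc k) → ∃ λ p → Dist G u p k × adj G p v ≡ true
  Dist-unsnoc (w , minimal) with walk-unsnoc w
  ... | p , w′ , e = p , (w′ , λ j wj → s≤s⁻¹ (minimal (suc j) (walk-snoc wj e))) , e

  adj⇒closedAdj : ∀ {x z} → adj G x z ≡ true → closedAdj G x z ≡ true
  adj⇒closedAdj {x} {z} e rewrite e = Bool.∨-zeroʳ (eqb x z)

  closedAdj⇒adj : ∀ {y z} → y ≢ z → closedAdj G y z ≡ true → adj G y z ≡ true
  closedAdj⇒adj {y} {z} y≢z h with y ≟ z
  ... | yes y≡z = contradiction y≡z y≢z
  ... | no  _   = h

  trueTwins-walk : ∀ {x y w k} → TrueTwins G x y → x ≢ w → Walk G x w k →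
                   ∃ λ j → j ≤ k × Walk G y w j
  trueTwins-walk twins x≢w nil = contradiction refl x≢w
  trueTwins-walk {y = y} {k = suc k} twins _ (cons {w = z} e w) with y ≟ z
  ... | yes refl = k , n≤1+n k , w
  ... | no  y≢z  = suc k , ≤-refl , cons (closedAdj⇒adj y≢z y~z) w
    where
    y~z : closedAdj G y z ≡ true
    y~z = trans (sym (twins z)) (adj⇒closedAdj e)

  Between-endpoint : ∀ {x y d} → Dist G x y d → Between G x y y
  Between-endpoint {d = d} dxy = d , d , 0 , dxy , dxy , Dist-refl , sym (+-identityʳ d)

  nonadjacent⇒¬Between : DiameterAtMost G 2 → ∀ {x y w} → x ≢ y → y ≢ w →
                         adj G x y ≡ false → ¬ Between G x y w
  nonadjacent⇒¬Between diam x≢y y≢w ¬e (a , b , c , dxw , (wxy , _) , (wyw , _) , a≡b+c) =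
    <-irrefl a≡b+c (≤-<-trans (≤-trans (diam _ _ _ dxw) 2≤b) (m<m+n b 1≤c))
    where
    2≤b : 2 ≤ b
    2≤b = nonadjacent⇒2≤walk x≢y ¬e wxy
    1≤c : 1 ≤ c
    1≤c = ≢⇒1≤walk y≢w wyw

  trueTwins⇒¬Between : ∀ {x y w} → x ≢ y → y ≢ w → TrueTwins G x y → ¬ Between G x y w
  trueTwins⇒¬Between x≢y y≢w twins (a , b , c , (_ , minimal) , (wxy , _) , (wyw , _) , a≡b+c)
    with trueTwins-walk (λ z → sym (twins z)) y≢w wyw
  ... | j , j≤c , wxw =
    <-irrefl a≡b+c (≤-<-trans (≤-trans (minimal j wxw) j≤c) (m<n+m c (≢⇒1≤walk x≢y wxy)))

  ∁pair-generator : Connected G → ∀ {a b w} → w ∈ ∁ (pair a b) → StronglyResolves G w a b →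
                    StrongMetricGenerator G (∁ (pair a b))
  ∁pair-generator conn {a} {b} {w} w∈ resolved x y x≢y
    with x ∈? ∁ (pair a b) | y ∈? ∁ (pair a b)
  ... | yes x∈ | _      = x , x∈ , inj₂ (Between-endpoint (proj₂ (Connected⇒Dist conn y x)))
  ... | no _   | yes y∈ = y , y∈ , inj₁ (Between-endpoint (proj₂ (Connected⇒Dist conn x y)))
  ... | no x∉  | no y∉  = w , w∈ , resolvedPair (∉∁pair x∉) (∉∁pair y∉)
    where
    resolvedPair : x ≡ a ⊎ x ≡ b → y ≡ a ⊎ y ≡ b → StronglyResolves G w x y
    resolvedPair (inj₁ refl) (inj₁ refl) = contradiction refl x≢y
    resolvedPair (inj₁ refl) (inj₂ refl) = resolved
    resolvedPair (inj₂ refl) (inj₁ refl) = swap resolved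
    resolvedPair (inj₂ refl) (inj₂ refl) = contradiction refl x≢y

module _ {G : Graph n} {S : Subset n} (gen : StrongMetricGenerator G S) where

  ∁generator-avoids : (R : Fin n → Fin n → Set) → (∀ {x y} → R x y → R y x) →
    (∀ {x y w} → x ≢ y → y ≢ w → R x y → ¬ Between G x y w) →
    ∀ x y → x ∈ ∁ S → y ∈ ∁ S → x ≢ y → ¬ R x y
  ∁generator-avoids R R-sym ¬Between x y x∈ y∈ x≢y Rxy with gen x y x≢y
  ... | w , w∈S , resolved =
    [ ¬Between x≢y (outside y∈) Rxy , ¬Between (x≢y ∘ sym) (outside x∈) (R-sym Rxy) ] resolved
    where
    outside : ∀ {z} → z ∈ ∁ S → z ≢ w
    outside z∈ refl = x∈∁p⇒x∉p z∈ w∈S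

  ∁generator-isTwinFreeClique : DiameterAtMost G 2 → IsTwinFreeClique G (∁ S)
  ∁generator-isTwinFreeClique diam = clique , twinFree
    where
    clique : IsClique G (∁ S)
    clique x y x∈ y∈ x≢y = Bool.¬-not (∁generator-avoids (λ x y → adj G x y ≡ false)
      (λ {x} {y} ¬e → trans (adj-sym G y x) ¬e) (nonadjacent⇒¬Between G diam) x y x∈ y∈ x≢y)
    twinFree : ∀ x y → x ∈ ∁ S → y ∈ ∁ S → x ≢ y → ¬ TrueTwins G x y
    twinFree = ∁generator-avoids (TrueTwins G) (λ twins z → sym (twins z))
      (trueTwins⇒¬Between G)

n∸ϖ≤∣S∣ : ∀ {G : Graph n} {k S} → IsVarpi G k → IsTwinFreeClique G (∁ S) → n ∸ k ≤ ∣ S ∣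
n∸ϖ≤∣S∣ {n} {k = k} {S} (_ , maximal) ∁S-twinFree = m∸n≤o⇒m∸o≤n n ∣ S ∣ k
  (subst (_≤ k) (∣∁p∣≡n∸∣p∣ S) (maximal (∁ S) ∁S-twinFree))

module _ (G : Graph n) where

  complement-adj⇒nonadjacent : ∀ {x y} → adj (complement G) x y ≡ true → adj G x y ≡ false
  complement-adj⇒nonadjacent {x} {y} h with adj G x y | h
  ... | false | _ = refl
  ... | true  | ()

  complement-nonadjacent⇒adj : ∀ {x y} → x ≢ y → adj (complement G) x y ≡ false →
                               adj G x y ≡ true
  complement-nonadjacent⇒adj {x} {y} x≢y h with adj G x y | h
  ... | true  | _  = refl
  ... | false | h′ with x ≟ y | h′
  ...   | yes x≡y | _  = contradiction x≡y x≢y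
  ...   | no  _   | ()

  far-in-complement⇒resolvable-pair : ∀ {u v d} → Dist (complement G) u v d → 3 ≤ d →
    ∃ λ p → u ≢ p × v ≢ u × v ≢ p ×
            StronglyResolves G v u p × StronglyResolves (complement G) v u p
  far-in-complement⇒resolvable-pair {u} {v} {suc d} duv (s≤s 2≤d)
    with Dist-unsnoc (complement G) duv
  ... | p , dup , p~ᶜv = p , u≢p , (u≢v ∘ sym) , (p≢v ∘ sym) , resolvesG , resolvesGᶜ
    where
    u≢p : u ≢ p
    u≢p = Dist-pos⇒≢ _ dup (≤-trans (s≤s z≤n) 2≤d)
    u≢v : u ≢ v
    u≢v = Dist-pos⇒≢ _ duv (s≤s z≤n)
    p≢v : p ≢ v
    p≢v = adj⇒≢ (complement G) p~ᶜv
    p~u : adj G p u ≡ true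
    p~u = trans (adj-sym G p u)
      (complement-nonadjacent⇒adj u≢p (Dist≥2⇒nonadjacent _ dup 2≤d))
    u~v : adj G u v ≡ true
    u~v = complement-nonadjacent⇒adj u≢v (Dist≥2⇒nonadjacent _ duv (≤-trans 2≤d (n≤1+n d)))
    p≁v : adj G p v ≡ false
    p≁v = complement-adj⇒nonadjacent p~ᶜv
    resolvesG : StronglyResolves G v u p
    resolvesG =
      inj₂ (2 , 1 , 1 , Dist₂ G p~u u~v p≁v p≢v , adj⇒Dist₁ G p~u , adj⇒Dist₁ G u~v , refl)
    resolvesGᶜ : StronglyResolves (complement G) v u p
    resolvesGᶜ = inj₁ (suc d , d , 1 , duv , dup , adj⇒Dist₁ (complement G) p~ᶜv , +-comm 1 d)

mainTheorem5 : (n : ℕ) (G : Graph n) →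
    HasDiameter G 2 → Connected (complement G) →
    ((k : ℕ) → IsVarpi G k → (S : Subset n) →
        StrongMetricGenerator G S → StrongMetricGenerator (complement G) S →
        n ∸ k ≤ ∣ S ∣)
    × ((Σ (Fin n) λ u → Σ (Fin n) λ v → Σ ℕ λ d → Dist (complement G) u v d × 3 ≤ d) →
        IsVarpi G 2 → IsSds G (complement G) (n ∸ 2))
mainTheorem5 n G (G-connected , diam≤2 , _) Gᶜ-connected = lowerBound , exactValue
  where
  lowerBound : (k : ℕ) → IsVarpi G k → (S : Subset n) →
    StrongMetricGenerator G S → StrongMetricGenerator (complement G) S → n ∸ k ≤ ∣ S ∣
  lowerBound _ ϖ _ gen _ = n∸ϖ≤∣S∣ {G = G} ϖ (∁generator-isTwinFreeClique gen diam≤2)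

  exactValue : (Σ (Fin n) λ u → Σ (Fin n) λ v → Σ ℕ λ d → Dist (complement G) u v d × 3 ≤ d) →
    IsVarpi G 2 → IsSds G (complement G) (n ∸ 2)
  exactValue (u , v , _ , duv , 3≤d) ϖ₂ with far-in-complement⇒resolvable-pair G duv 3≤d
  ... | p , u≢p , v≢u , v≢p , resolvesG , resolvesGᶜ =
    (∁ (pair u p) , genG , genGᶜ , ≤-antisym (∣∁pair∣≤n∸2 u≢p) (lowerBound 2 ϖ₂ _ genG genGᶜ)) ,
    lowerBound 2 ϖ₂
    where
    genG : StrongMetricGenerator G (∁ (pair u p))
    genG = ∁pair-generator G G-connected (∈∁pair v≢u v≢p) resolvesG
    genGᶜ : StrongMetricGenerator (complement G) (∁ (pair u p))
    genGᶜ = ∁pair-generator (complement G) Gᶜ-connected (∈∁pair v≢u v≢p) resolvesGᶜ
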